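{- For all $k,r,p>0$ there is $m$ such that for every $n\ge m$ and every $F:[n]^k\to[n]^r$ satisfying $|F(x)|\le\min(x)$ for all $x$, there is a $p$-element $E\subseteq[n]$ with $|F[E^k]|\le k^k\cdot p$.
   Context: $[n]=\{0,1,\dots,n-1\}$. For a tuple $x$ of natural numbers, $\min(x)$ is its least coordinate and $|x|$ its largest coordinate. $|F[E^k]|$ is the cardinality of the image of $E^k$ under $F$. -}

module Defs where

open import Data.Nat using (ℕ; zero; suc; _⊔_; _⊓_)
open import Data.Fin using (Fin; toℕ)
open import Data.Fin.Properties using (_≟_)
open import Data.Fin.Subset using (Subset; _∈_)
open import Data.Fin.Subset.Properties using (_∈?_)
open import Data.List using (List; []; _∷_; concatMap; map; filter; length; allFin; deduplicate)
open import Data.List.Base using ([_])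
open import Data.Vec using (Vec; []; _∷_)
open import Data.Vec.Properties using (≡-dec)
open import Data.Vec.Relation.Unary.All as VAll using (All)

-- Largest coordinate |x| of a tuple of elements of [n] (0 for the empty tuple).
maxCoord : ∀ {n k} → Vec (Fin n) k → ℕ
maxCoord []       = 0
maxCoord (x ∷ xs) = toℕ x ⊔ maxCoord xs

-- Least coordinate min(x) of a tuple (only used for nonempty tuples; 0 for the empty one).
minCoord : ∀ {n k} → Vec (Fin n) k → ℕ
minCoord []           = 0
minCoord (x ∷ [])     = toℕ x
minCoord (x ∷ y ∷ xs) = toℕ x ⊓ minCoord (y ∷ xs)

allTuples : (n k : ℕ) → List (Vec (Fin n) k)
allTuples n zero    = [ [] ]
allTuples n (suc k) = concatMap (λ a → map (a ∷_) (allTuples n k)) (allFin n)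

power : ∀ {n} → Subset n → (k : ℕ) → List (Vec (Fin n) k)
power {n} E k = filter (λ x → VAll.all? (_∈? E) x) (allTuples n k)

imageCard : ∀ {n k r} → (Vec (Fin n) k → Vec (Fin n) r) → Subset n → ℕ
imageCard {k = k} F E = length (deduplicate (≡-dec _≟_) (map F (power E k)))

module Submission where

-- Colour each k-set Y = {y₀ < … < y_{k-1}} of naturals by the values of F, clipped at y₀, at all k-tuples
-- with coordinates in Y.  Once y₀ is fixed there are only finitely many colours, so the Kanamori–McAloon
-- theorem gives a min-homogeneous set H of size p + k - 1; it is obtained constructively from a bar for
-- the Erdős–Rado game, made finite by a fan argument.  Let E consist of the first p elements of H and Hx
-- of the last k - 1.  A tuple over E has the same colour as {a} ∪ Hx for a its least coordinate, so F[E^k]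
-- is covered by the values of F at the k^k tuples over {a} ∪ Hx, for the p choices of a ∈ E.

open import Defs
open import Data.Nat using (ℕ; _≤_; _≥_; _>_; _*_; _^_)
open import Data.Fin using (Fin)
open import Data.Fin.Subset using (Subset; ∣_∣)
open import Data.Vec using (Vec)
open import Data.Vec using ([]; _∷_)
open import Data.Product using (Σ; _×_)
open import Relation.Binary.PropositionalEquality using (_≡_)

open import Data.Nat using (zero; suc; _+_; _∸_; _<_; z≤n; s≤s; s≤s⁻¹; _⊔_; _⊓_; pred)
open import Data.Nat.Properties
open import Data.Fin using (zero; suc; toℕ; fromℕ; fromℕ<)
open import Data.Fin.Properties using (toℕ-fromℕ<; toℕ-fromℕ; toℕ≤pred[n]; toℕ-injective) renaming (_≟_ to _≟F_)
open import Data.Fin.Subset using (⁅_⁆; _∪_; inside; outside) renaming (⊥ to ⊥ₛ; _∈_ to _∈ₛ_; _∉_ to _∉ₛ_)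
open import Data.Fin.Subset.Properties using (x∈p∪q⁻; x∈⁅y⁆⇒x≡y; ∪-identityˡ; ∉⊥; ∣⊥∣≡0)
  renaming (_∈?_ to _∈?ₛ_)
open import Data.List
  using (List; []; _∷_; _++_; [_]; length; map; concatMap; take; drop; filter; foldr; allFin; replicate; deduplicate)
open import Data.List.Properties
  using ( ≡-dec; length-take; length-drop; take++drop≡id; ∷ʳ-injective; length-removeAt′; ∷-injective; length-++
        ; length-map; length-tabulate; map-∘; map-id-local)
open import Data.List.Membership.DecPropositional _≟_ using (_∈?_)
open import Data.List.Membership.Propositional using (_∈_; _∉_; find; _─_)
open import Data.List.Membership.Propositional.Properties
  using ( ∈-map⁺; ∈-map⁻; ∈-++⁺ˡ; ∈-++⁺ʳ; ∈-++⁻; ∈-concatMap⁺; ∈-concatMap⁻; ∈-allFin; ∈-filter⁺; ∈-filter⁻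
        ; ∈-deduplicate⁻)
open import Data.List.Relation.Unary.Any as Any using (here; there)
open import Data.List.Relation.Unary.All as All using (All; []; _∷_)
import Data.List.Relation.Unary.All.Properties as Allₚ
open import Data.List.Relation.Unary.AllPairs as AllPairs using (AllPairs; []; _∷_)
import Data.List.Relation.Unary.AllPairs.Properties as AllPairsₚ
open import Data.List.Relation.Unary.Unique.Propositional using (Unique)
import Data.List.Relation.Unary.Unique.Propositional.Properties as Unique
import Data.List.Relation.Unary.Unique.DecPropositional.Properties as UniqueDec
open import Data.List.Relation.Binary.Pointwise using (Pointwise; []; _∷_)
open import Data.List.Relation.Binary.Sublist.Propositional as Sublist
  using (_⊆_; []; _∷_; _∷ʳ_; ⊆-refl; ⊆-trans; minimum; from∈)
open import Data.List.Relation.Binary.Sublist.Propositional.Properties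
  using (++⁺; ++⁺ʳ; take-⊆; filter-⊆; All-resp-⊆)
import Data.Vec as Vec
import Data.Vec.Properties as VecP
import Data.Vec.Relation.Unary.All as VAll
open import Data.Product using (∃; _,_; proj₁; proj₂)
open import Data.Sum using (_⊎_; inj₁; inj₂)
open import Data.Empty using (⊥; ⊥-elim)
open import Data.Unit using (⊤; tt)
open import Relation.Binary.PropositionalEquality
  using (_≢_; refl; sym; trans; cong; cong₂; subst; module ≡-Reasoning)
open import Relation.Nullary using (yes; no)

private variable A B : Set

⊆-∷ʳ : ∀ {xs ys : List A} v → xs ⊆ ys → xs ⊆ ys ++ [ v ]
⊆-∷ʳ v = ++⁺ʳ [ v ]

∷ʳ-⊆ : ∀ {xs ys : List A} v → xs ++ [ v ] ⊆ ys → xs ⊆ ys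
∷ʳ-⊆ v = ⊆-trans (++⁺ʳ [ v ] ⊆-refl)

∷ʳ-⊆-∷ʳ : ∀ {xs ys : List A} v → xs ⊆ ys → xs ++ [ v ] ⊆ ys ++ [ v ]
∷ʳ-⊆-∷ʳ v p = ++⁺ p ⊆-refl

⊆-∷ʳ⁻ : ∀ {ys} (us : List A) v → ys ⊆ us ++ [ v ] →
  ys ⊆ us ⊎ ∃ λ ws → ys ≡ ws ++ [ v ] × ws ⊆ us
⊆-∷ʳ⁻ []       v (_ ∷ʳ [])    = inj₁ []
⊆-∷ʳ⁻ []       v (refl ∷ [])  = inj₂ ([] , refl , [])
⊆-∷ʳ⁻ (u ∷ us) v (_ ∷ʳ p) with ⊆-∷ʳ⁻ us v p
... | inj₁ q            = inj₁ (u ∷ʳ q)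
... | inj₂ (ws , e , q) = inj₂ (ws , e , u ∷ʳ q)
⊆-∷ʳ⁻ (u ∷ us) v (refl ∷ p) with ⊆-∷ʳ⁻ us v p
... | inj₁ q               = inj₁ (refl ∷ q)
... | inj₂ (ws , refl , q) = inj₂ (u ∷ ws , refl , refl ∷ q)

length-∷ʳ : ∀ (ws : List A) v → length (ws ++ [ v ]) ≡ suc (length ws)
length-∷ʳ []       v = refl
length-∷ʳ (w ∷ ws) v = cong suc (length-∷ʳ ws v)

length-take-≤ : ∀ n (xs : List A) → n ≤ length xs → length (take n xs) ≡ n
length-take-≤ n xs n≤ = trans (length-take n xs) (m≤n⇒m⊓n≡m n≤)

∉-above : ∀ {ys us v} → ys ⊆ us → All (_< v) us → v ∉ ys
∉-above p us<v v∈ys = <-irrefl refl (All.lookup (All-resp-⊆ p us<v) v∈ys)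

-- The list [0, …, n-1] built by snoc, so that range (suc n) reduces to range n ++ [ n ].
range : ℕ → List ℕ
range zero    = []
range (suc n) = range n ++ [ n ]

range-< : ∀ n → All (_< n) (range n)
range-< zero    = []
range-< (suc n) = Allₚ.∷ʳ⁺ (All.map m<n⇒m<1+n (range-< n)) ≤-refl

range-mono : ∀ {m n} → m ≤ n → range m ⊆ range n
range-mono {n = zero}  z≤n = []
range-mono {n = suc n} m≤1+n with m≤n⇒m<n∨m≡n m≤1+n
... | inj₁ m<1+n = ⊆-∷ʳ n (range-mono (s≤s⁻¹ m<1+n))
... | inj₂ refl  = ⊆-refl

∈-range⁺ : ∀ {x n} → x < n → x ∈ range n
∈-range⁺ {x} {suc n} x<1+n with m≤n⇒m<n∨m≡n x<1+n
... | inj₁ x<n  = ∈-++⁺ˡ (∈-range⁺ (s≤s⁻¹ x<n))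
... | inj₂ refl = ∈-++⁺ʳ (range x) (here refl)

AllPairs-resp-⊇ : ∀ {R : A → A → Set} {xs ys} → xs ⊆ ys → AllPairs R ys → AllPairs R xs
AllPairs-resp-⊇ []         []        = []
AllPairs-resp-⊇ (_ ∷ʳ p)   (_ ∷ Rys) = AllPairs-resp-⊇ p Rys
AllPairs-resp-⊇ (refl ∷ p) (Ry ∷ Rys) = All-resp-⊆ p Ry ∷ AllPairs-resp-⊇ p Rys

range-increasing : ∀ n → AllPairs _<_ (range n)
range-increasing zero    = []
range-increasing (suc n) = AllPairsₚ.++⁺ (range-increasing n) ([] ∷ []) (All.map (_∷ []) (range-< n))

first : List ℕ → ℕ
first []      = 0
first (x ∷ _) = x

first-++ : ∀ (xs ys : List ℕ) → xs ≢ [] → first (xs ++ ys) ≡ first xs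
first-++ []       ys xs≢[] = ⊥-elim (xs≢[] refl)
first-++ (x ∷ xs) ys _     = refl

∷ʳ≢[] : ∀ (xs : List A) v → xs ++ [ v ] ≢ []
∷ʳ≢[] []       v ()
∷ʳ≢[] (x ∷ xs) v ()

combinations : ℕ → List A → List (List A)
combinations zero    us       = [ [] ]
combinations (suc j) []       = []
combinations (suc j) (u ∷ us) = map (u ∷_) (combinations j us) ++ combinations (suc j) us

∈-combinations⁺ : ∀ {ws us : List A} j → ws ⊆ us → length ws ≡ j → ws ∈ combinations j us
∈-combinations⁺ {ws = []}    zero    _          refl = here refl
∈-combinations⁺ {ws = _ ∷ _} zero    _          ()
∈-combinations⁺ {us = u ∷ us} (suc j) (_ ∷ʳ p)   e    =
  ∈-++⁺ʳ (map (u ∷_) (combinations j us)) (∈-combinations⁺ (suc j) p e)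
∈-combinations⁺ {us = u ∷ us} (suc j) (refl ∷ p) e    =
  ∈-++⁺ˡ (∈-map⁺ (u ∷_) (∈-combinations⁺ j p (suc-injective e)))

∈-combinations⁻ : ∀ {ws} j (us : List A) → ws ∈ combinations j us → ws ⊆ us × length ws ≡ j
∈-combinations⁻ zero    us       (here refl) = minimum us , refl
∈-combinations⁻ (suc j) (u ∷ us) m with ∈-++⁻ (map (u ∷_) (combinations j us)) m
... | inj₂ m′ = let p , e = ∈-combinations⁻ (suc j) us m′ in u ∷ʳ p , e
... | inj₁ m′ with ∈-map⁻ (u ∷_) m′
...   | ws , m″ , refl = let p , e = ∈-combinations⁻ j us m″ in refl ∷ p , cong suc e

choices : List (List A) → List (List A)
choices []         = [ [] ]
choices (xs ∷ xss) = concatMap (λ x → map (x ∷_) (choices xss)) xs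

∈-choices⁺ : ∀ {ys : List A} {xss} → Pointwise _∈_ ys xss → ys ∈ choices xss
∈-choices⁺ [] = here refl
∈-choices⁺ {ys = y ∷ ys} {xs ∷ xss} (y∈xs ∷ p) =
  ∈-concatMap⁺ (λ x → map (x ∷_) (choices xss)) (Any.map (λ { refl → ∈-map⁺ (y ∷_) (∈-choices⁺ p) }) y∈xs)

∈-choices⁻ : ∀ {ys : List A} xss → ys ∈ choices xss → Pointwise _∈_ ys xss
∈-choices⁻ []         (here refl) = []
∈-choices⁻ (xs ∷ xss) m with find (∈-concatMap⁻ (λ x → map (x ∷_) (choices xss)) {xs = xs} m)
... | x , x∈xs , m′ with ∈-map⁻ (x ∷_) m′
...   | ys , m″ , refl = x∈xs ∷ ∈-choices⁻ xss m″

∈-choices-map⁺ : ∀ (f : A → B) (g : A → List B) xs → (∀ x → x ∈ xs → f x ∈ g x) →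
  map f xs ∈ choices (map g xs)
∈-choices-map⁺ f g xs f∈g = ∈-choices⁺ (pointwise xs f∈g)
  where
  pointwise : ∀ xs → (∀ x → x ∈ xs → f x ∈ g x) → Pointwise _∈_ (map f xs) (map g xs)
  pointwise []       _   = []
  pointwise (x ∷ xs) f∈g = f∈g x (here refl) ∷ pointwise xs (λ y y∈ → f∈g y (there y∈))

map-≡-∈ : ∀ {f g : A → B} {x} xs → map f xs ≡ map g xs → x ∈ xs → f x ≡ g x
map-≡-∈ (y ∷ xs) fxs≡gxs (here refl) = proj₁ (∷-injective fxs≡gxs)
map-≡-∈ (y ∷ xs) fxs≡gxs (there x∈) = map-≡-∈ xs (proj₂ (∷-injective fxs≡gxs)) x∈

length-concatMap-const : ∀ (f : A → List B) xs c → (∀ x → length (f x) ≡ c) →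
  length (concatMap f xs) ≡ length xs * c
length-concatMap-const f []       c _     = refl
length-concatMap-const f (x ∷ xs) c ∣f∣≡c =
  trans (length-++ (f x)) (cong₂ _+_ (∣f∣≡c x) (length-concatMap-const f xs c ∣f∣≡c))

∈-allTuples : ∀ n k (x : Vec (Fin n) k) → x ∈ allTuples n k
∈-allTuples n zero    []      = here refl
∈-allTuples n (suc k) (a ∷ x) = ∈-concatMap⁺ (λ b → map (b ∷_) (allTuples n k))
  (Any.map (λ { refl → ∈-map⁺ (a ∷_) (∈-allTuples n k x) }) (∈-allFin a))

length-allTuples : ∀ n k → length (allTuples n k) ≡ n ^ k
length-allTuples n zero    = refl
length-allTuples n (suc k) = begin
  length (allTuples n (suc k))  ≡⟨ length-concatMap-const (λ b → map (b ∷_) (allTuples n k)) (allFin n) (n ^ k)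
                                     (λ b → trans (length-map (b ∷_) (allTuples n k)) (length-allTuples n k)) ⟩
  length (allFin n) * n ^ k     ≡⟨ cong (_* n ^ k) (length-tabulate {n = n} (λ f → f)) ⟩
  n * n ^ k                     ∎
  where open ≡-Reasoning

∈-─ : ∀ {x y : A} {ys} (x∈ys : x ∈ ys) → y ∈ ys → y ≢ x → y ∈ ys ─ x∈ys
∈-─ (here refl) (here refl)  y≢x = ⊥-elim (y≢x refl)
∈-─ (here refl) (there y∈ys) _   = y∈ys
∈-─ (there _)   (here y≡)    _   = here y≡
∈-─ (there x∈)  (there y∈ys) y≢x = there (∈-─ x∈ y∈ys y≢x)

Unique-length-≤ : ∀ {xs ys : List A} → Unique xs → (∀ {y} → y ∈ xs → y ∈ ys) → length xs ≤ length ys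
Unique-length-≤ {xs = []}     _              _    = z≤n
Unique-length-≤ {xs = x ∷ xs} {ys} (x∉xs ∷ !xs) xs⊆ys = begin
  suc (length xs)            ≤⟨ s≤s (Unique-length-≤ !xs xs⊆ys─x) ⟩
  suc (length (ys ─ x∈ys))   ≡⟨ length-removeAt′ ys (Any.index x∈ys) ⟨
  length ys                  ∎
  where
  open ≤-Reasoning
  x∈ys = xs⊆ys (here refl)
  xs⊆ys─x : ∀ {y} → y ∈ xs → y ∈ ys ─ x∈ys
  xs⊆ys─x y∈xs = ∈-─ x∈ys (xs⊆ys (there y∈xs)) (λ y≡x → All.lookup x∉xs y∈xs (sym y≡x))

∣⁅x⁆∪p∣ : ∀ {n} (x : Fin n) (p : Subset n) → x ∉ₛ p → ∣ ⁅ x ⁆ ∪ p ∣ ≡ suc ∣ p ∣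
∣⁅x⁆∪p∣ zero    (outside ∷ p) _   = cong (λ q → suc ∣ q ∣) (∪-identityˡ p)
∣⁅x⁆∪p∣ zero    (inside  ∷ p) x∉p = ⊥-elim (x∉p Vec.here)
∣⁅x⁆∪p∣ (suc x) (outside ∷ p) x∉p = ∣⁅x⁆∪p∣ x p (λ x∈p → x∉p (Vec.there x∈p))
∣⁅x⁆∪p∣ (suc x) (inside  ∷ p) x∉p = cong suc (∣⁅x⁆∪p∣ x p (λ x∈p → x∉p (Vec.there x∈p)))

subsetOf : ∀ {n} → List (Fin n) → Subset n
subsetOf = foldr (λ x p → ⁅ x ⁆ ∪ p) ⊥ₛ

∈-subsetOf⁻ : ∀ {n} {x : Fin n} xs → x ∈ₛ subsetOf xs → x ∈ xs
∈-subsetOf⁻ []       x∈ = ⊥-elim (∉⊥ x∈)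
∈-subsetOf⁻ (y ∷ xs) x∈ with x∈p∪q⁻ ⁅ y ⁆ (subsetOf xs) x∈
... | inj₁ x∈⁅y⁆ = here (x∈⁅y⁆⇒x≡y y x∈⁅y⁆)
... | inj₂ x∈xs  = there (∈-subsetOf⁻ xs x∈xs)

∣subsetOf∣ : ∀ {n} {xs : List (Fin n)} → Unique xs → ∣ subsetOf xs ∣ ≡ length xs
∣subsetOf∣ {n} []                    = ∣⊥∣≡0 n
∣subsetOf∣ {xs = x ∷ xs} (x∉xs ∷ !xs) =
  trans (∣⁅x⁆∪p∣ x (subsetOf xs) (λ x∈ → All.lookup x∉xs (∈-subsetOf⁻ xs x∈) refl))
        (cong suc (∣subsetOf∣ !xs))

clamp : (m : ℕ) → ℕ → Fin (suc m)
clamp m x with x ≤? m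
... | yes x≤m = fromℕ< (s≤s x≤m)
... | no _    = fromℕ m

toℕ-clamp : ∀ {m x} → x ≤ m → toℕ (clamp m x) ≡ x
toℕ-clamp {m} {x} x≤m with x ≤? m
... | yes x≤m′ = toℕ-fromℕ< (s≤s x≤m′)
... | no x≰m   = ⊥-elim (x≰m x≤m)

toℕ-clamp-≤ : ∀ m x → toℕ (clamp m x) ≤ x
toℕ-clamp-≤ m x with x ≤? m
... | yes x≤m = ≤-reflexive (toℕ-fromℕ< (s≤s x≤m))
... | no x≰m  = subst (_≤ x) (sym (toℕ-fromℕ m)) (<⇒≤ (≰⇒> x≰m))

clamp-toℕ : ∀ {m} (f : Fin (suc m)) → clamp m (toℕ f) ≡ f
clamp-toℕ {m} f = toℕ-injective (toℕ-clamp (toℕ≤pred[n] f))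

nth : List ℕ → ℕ → ℕ
nth []       _       = 0
nth (x ∷ xs) zero    = x
nth (x ∷ xs) (suc j) = nth xs j

position : ℕ → List ℕ → ℕ
position v []       = 0
position v (x ∷ xs) with v ≟ x
... | yes _ = 0
... | no _  = suc (position v xs)

position-< : ∀ {v xs} → v ∈ xs → position v xs < length xs
position-< {v} {x ∷ xs} v∈ with v ≟ x
... | yes _ = s≤s z≤n
position-< {v} {x ∷ xs} (here v≡x) | no v≢x = ⊥-elim (v≢x v≡x)
position-< {v} {x ∷ xs} (there v∈) | no _   = s≤s (position-< v∈)

nth-position : ∀ {v xs} → v ∈ xs → nth xs (position v xs) ≡ v
nth-position {v} {x ∷ xs} v∈ with v ≟ x
... | yes v≡x = sym v≡x
nth-position {v} {x ∷ xs} (here v≡x) | no v≢x = ⊥-elim (v≢x v≡x)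
nth-position {v} {x ∷ xs} (there v∈) | no _   = nth-position v∈

coords : ∀ {n m} → Vec (Fin n) m → List ℕ
coords []      = []
coords (f ∷ w) = toℕ f ∷ coords w

length-coords : ∀ {n m} (w : Vec (Fin n) m) → length (coords w) ≡ m
length-coords []      = refl
length-coords (f ∷ w) = cong suc (length-coords w)

coords-injective : ∀ {n m} (w w′ : Vec (Fin n) m) → coords w ≡ coords w′ → w ≡ w′
coords-injective []      []        _ = refl
coords-injective (f ∷ w) (f′ ∷ w′) e =
  cong₂ _∷_ (toℕ-injective (proj₁ (∷-injective e))) (coords-injective w w′ (proj₂ (∷-injective e)))

minCoord-≤ : ∀ {n m a} (x : Vec (Fin n) m) → a ∈ coords x → minCoord x ≤ a
minCoord-≤ (f ∷ [])     (here refl)  = ≤-refl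
minCoord-≤ (f ∷ g ∷ x)  (here refl)  = m⊓n≤m _ _
minCoord-≤ (f ∷ g ∷ x)  (there a∈)   = ≤-trans (m⊓n≤n _ _) (minCoord-≤ (g ∷ x) a∈)

-- The min-homogeneity game

-- Bar Move next Goal s: whatever moves the opponent makes from s, Goal is reached after finitely many.
data Bar {S : Set} (Move : S → Set) (next : (s : S) → Move s → S) (Goal : S → Set) : S → Set where
  now   : ∀ {s} → Goal s → Bar Move next Goal s
  later : ∀ {s} → ((m : Move s) → Bar Move next Goal (next s m)) → Bar Move next Goal s

module Colouring (C : Set) (default : C) where

  lookupTable : List (List ℕ) → List C → List ℕ → C
  lookupTable (x ∷ xs) (κ ∷ κs) Y with ≡-dec _≟_ x Y
  ... | yes _ = κ
  ... | no _  = lookupTable xs κs Y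
  lookupTable _        _        Y = default

  lookupTable-map : ∀ (f : List ℕ → C) xs Y → Y ∈ xs → lookupTable xs (map f xs) Y ≡ f Y
  lookupTable-map f (x ∷ xs) Y m with ≡-dec _≟_ x Y
  ... | yes x≡Y = cong f x≡Y
  lookupTable-map f (x ∷ xs) Y (here Y≡x) | no x≢Y = ⊥-elim (x≢Y (sym Y≡x))
  lookupTable-map f (x ∷ xs) Y (there m)  | no _   = lookupTable-map f xs Y m

  lookupTable-∈ : ∀ {κs} (g : List ℕ → List C) xs Y → Pointwise _∈_ κs (map g xs) → Y ∈ xs →
    lookupTable xs κs Y ∈ g Y
  lookupTable-∈ g (x ∷ xs) Y (κ∈ ∷ p) m with ≡-dec _≟_ x Y
  ... | yes refl = κ∈
  lookupTable-∈ g (x ∷ xs) Y (κ∈ ∷ p) (here Y≡x) | no x≢Y = ⊥-elim (x≢Y (sym Y≡x))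
  lookupTable-∈ g (x ∷ xs) Y (κ∈ ∷ p) (there m)  | no _   = lookupTable-∈ g xs Y p m

  extensions : ℕ → List ℕ → ℕ → List (List ℕ)
  extensions i us v = map (_++ [ v ]) (combinations i us)

  ∈-extensions⁺ : ∀ {ws us : List ℕ} i v → ws ⊆ us → length ws ≡ i → ws ++ [ v ] ∈ extensions i us v
  ∈-extensions⁺ i v p e = ∈-map⁺ (_++ [ v ]) (∈-combinations⁺ i p e)

  ∈-extensions⁻ : ∀ {Y} i (us : List ℕ) v → Y ∈ extensions i us v →
    ∃ λ ws → Y ≡ ws ++ [ v ] × ws ⊆ us × length ws ≡ i
  ∈-extensions⁻ i us v m with ∈-map⁻ (_++ [ v ]) m
  ... | ws , m′ , e = ws , e , ∈-combinations⁻ i us m′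

  recolour : ℕ → (List ℕ → C) → ℕ → List ℕ → List C → List ℕ → C
  recolour i c v us κ Y with v ∈? Y
  ... | yes _ = lookupTable (extensions i us v) κ Y
  ... | no _  = c Y

  recolour-∉ : ∀ i c v us κ Y → v ∉ Y → recolour i c v us κ Y ≡ c Y
  recolour-∉ i c v us κ Y v∉Y with v ∈? Y
  ... | yes v∈Y = ⊥-elim (v∉Y v∈Y)
  ... | no _    = refl

  recolour-∈ : ∀ i c v us κ Y → v ∈ Y → recolour i c v us κ Y ≡ lookupTable (extensions i us v) κ Y
  recolour-∈ i c v us κ Y v∈Y with v ∈? Y
  ... | yes _   = refl
  ... | no v∉Y  = ⊥-elim (v∉Y v∈Y)

-- The game behind the Kanamori–McAloon theorem: the opponent keeps adding a new largest element
-- and colours the new j-sets, a j-set Y with a colour from admissible (first Y); the player wins as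
-- soon as a min-homogeneous set of size q appears.
module Game (C : Set) (default : C) (admissible : ℕ → List C) (q : ℕ) where
  open Colouring C default

  record State : Set where
    constructor state
    field
      chosen : List ℕ
      colour : List ℕ → C
  open State public

  AgreeOn : ℕ → List ℕ → (List ℕ → C) → (List ℕ → C) → Set
  AgreeOn j us c′ c = ∀ Y → Y ⊆ us → length Y ≡ j → c′ Y ≡ c Y

  AdmissibleAt : ℕ → List ℕ → ℕ → (List ℕ → C) → Set
  AdmissibleAt j us v c′ =
    ∀ ws → ws ⊆ us → length ws ≡ pred j → c′ (ws ++ [ v ]) ∈ admissible (first (ws ++ [ v ]))

  agreeOn-recolour : ∀ i us a (c c₀ : List ℕ → C) → All (_< a) us → AgreeOn (suc i) us c c₀ →
    AgreeOn (suc i) (us ++ [ a ]) c (recolour i c₀ a us (map c (extensions i us a)))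
  agreeOn-recolour i us a c c₀ us<a agree Y Y⊆ ∣Y∣ with ⊆-∷ʳ⁻ us a Y⊆
  ... | inj₁ Y⊆us = trans (agree Y Y⊆us ∣Y∣) (sym (recolour-∉ i c₀ a us κ Y (∉-above Y⊆us us<a)))
    where κ = map c (extensions i us a)
  ... | inj₂ (ws , refl , ws⊆) = sym (begin
    recolour i c₀ a us κ (ws ++ [ a ])         ≡⟨ recolour-∈ i c₀ a us κ (ws ++ [ a ]) (∈-++⁺ʳ ws (here refl)) ⟩
    lookupTable (extensions i us a) κ (ws ++ [ a ])
      ≡⟨ lookupTable-map c (extensions i us a) (ws ++ [ a ])
           (∈-extensions⁺ i a ws⊆ (suc-injective (trans (sym (length-∷ʳ ws a)) ∣Y∣))) ⟩
    c (ws ++ [ a ])                            ∎)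
    where
    open ≡-Reasoning
    κ = map c (extensions i us a)

  Move : ℕ → State → Set
  Move j s = Σ ℕ λ v → Σ (List ℕ → C) λ c′ →
    All (_< v) (chosen s) × AgreeOn j (chosen s) c′ (colour s) × AdmissibleAt j (chosen s) v c′

  play : (j : ℕ) → (s : State) → Move j s → State
  play j s (v , c′ , _) = state (chosen s ++ [ v ]) c′

  MinHomogeneous : ℕ → (List ℕ → C) → List ℕ → Set
  MinHomogeneous j c H = ∀ Z Z′ → Z ⊆ H → Z′ ⊆ H → length Z ≡ j → length Z′ ≡ j →
    first Z ≡ first Z′ → c Z ≡ c Z′

  HasMinHomogeneous : ℕ → List ℕ → (List ℕ → C) → Set
  HasMinHomogeneous j us c = Σ (List ℕ) λ H → H ⊆ us × length H ≡ q × MinHomogeneous j c H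

  Won : ℕ → State → Set
  Won j s = HasMinHomogeneous j (chosen s) (colour s)

  Winnable : ℕ → State → Set
  Winnable j = Bar (Move j) (play j) (Won j)

  start : State
  start = state [] (λ _ → default)

  winnable-1 : Winnable 1 start
  winnable-1 = after q start ≤-refl
    where
    singleton : ∀ (Z : List ℕ) → length Z ≡ 1 → ∃ λ x → Z ≡ [ x ]
    singleton (x ∷ []) refl = x , refl

    minHomogeneous-1 : ∀ c H → MinHomogeneous 1 c H
    minHomogeneous-1 c H Z Z′ _ _ ∣Z∣≡1 ∣Z′∣≡1 first≡ with singleton Z ∣Z∣≡1 | singleton Z′ ∣Z′∣≡1
    ... | x , refl | x′ , refl = cong (λ y → c [ y ]) first≡

    after : ∀ e s → q ≤ length (chosen s) + e → Winnable 1 s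
    after zero    s q≤ = now (take q (chosen s) , take-⊆ q (chosen s) ,
      length-take-≤ q (chosen s) (subst (q ≤_) (+-identityʳ _) q≤) , minHomogeneous-1 (colour s) _)
    after (suc e) s q≤ = later λ { m@(v , _) → after e (play 1 s m)
      (subst (q ≤_) (trans (+-suc (length (chosen s)) e) (cong (_+ e) (sym (length-∷ʳ (chosen s) v)))) q≤) }

  module Patterns (i : ℕ) where
    newColourOptions : List ℕ → ℕ → List (List C)
    newColourOptions us a = map (λ Y → admissible (first Y)) (extensions i us a)

    patterns : List ℕ → ℕ → List (List C)
    patterns us a = choices (newColourOptions us a)

    child : State → ℕ → List C → State
    child s a κ = state (chosen s ++ [ a ]) (recolour i (colour s) a (chosen s) κ)

    IsPattern : State → ℕ → List C → Set
    IsPattern s a κ = Pointwise _∈_ κ (newColourOptions (chosen s) a)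

    childMove : ∀ s a → All (_< a) (chosen s) → ∀ κ → IsPattern s a κ → Move (suc i) s
    childMove s a a> κ isPattern = a , recolour i (colour s) a (chosen s) κ , a> , agree , admissibleAt
      where
      agree : AgreeOn (suc i) (chosen s) (recolour i (colour s) a (chosen s) κ) (colour s)
      agree Y Y⊆ _ = recolour-∉ i (colour s) a (chosen s) κ Y (∉-above Y⊆ a>)
      admissibleAt : AdmissibleAt (suc i) (chosen s) a (recolour i (colour s) a (chosen s) κ)
      admissibleAt ws ws⊆ ∣ws∣ =
        subst (_∈ admissible (first (ws ++ [ a ])))
          (sym (recolour-∈ i (colour s) a (chosen s) κ (ws ++ [ a ]) (∈-++⁺ʳ ws (here refl))))
          (lookupTable-∈ (λ Y → admissible (first Y)) (extensions i (chosen s) a) (ws ++ [ a ])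
            isPattern (∈-extensions⁺ i a ws⊆ ∣ws∣))

  -- The Erdős–Rado tree argument, from j = suc i to k = suc j.  Along a branch of the tree the colour
  -- of a k-set Y ++ [ z ] is the colour of Y in the j-colouring of the branch (EndHomogeneous), so a
  -- min-homogeneous set for that j-colouring is one for the k-colouring.
  module ErdosRado (i : ℕ) where
    j k : ℕ
    j = suc i
    k = suc j

    open Patterns i

    mutual
      data Tree (s : State) : Set where
        leaf : Tree s
        node : (a : ℕ) → All (_< a) (chosen s) → Children s a (patterns (chosen s) a) → Tree s

      data Children (s : State) (a : ℕ) : List (List C) → Set where
        []  : Children s a []
        _∷_ : ∀ {κ κs} → Tree (child s a κ) → Children s a κs → Children s a (κ ∷ κs)

    mutual
      Grow : ∀ {s} → Tree s → Set
      Grow {s} leaf       = Σ ℕ λ z → All (_< z) (chosen s)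
      Grow (node a _ ts)  = GrowChildren ts

      GrowChildren : ∀ {s a κs} → Children s a κs → Set
      GrowChildren []       = ⊥
      GrowChildren (t ∷ ts) = Grow t ⊎ GrowChildren ts

    leaves : ∀ {s a} κs → Children s a κs
    leaves []       = []
    leaves (κ ∷ κs) = leaf ∷ leaves κs

    mutual
      grow : ∀ {s} (t : Tree s) → Grow t → Tree s
      grow leaf          (z , z>) = node z z> (leaves _)
      grow (node a a> ts) m        = node a a> (growChildren ts m)

      growChildren : ∀ {s a κs} (ts : Children s a κs) → GrowChildren ts → Children s a κs
      growChildren (t ∷ ts) (inj₁ m) = grow t m ∷ ts
      growChildren (t ∷ ts) (inj₂ m) = t ∷ growChildren ts m

    mutual
      WonInTree : ∀ {s} → Tree s → Set
      WonInTree {s} t = Won j s ⊎ WonBelow t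

      WonBelow : ∀ {s} → Tree s → Set
      WonBelow leaf          = ⊥
      WonBelow (node _ _ ts) = WonInChildren ts

      WonInChildren : ∀ {s a κs} → Children s a κs → Set
      WonInChildren []       = ⊥
      WonInChildren (t ∷ ts) = WonInTree t ⊎ WonInChildren ts

    TreeBar : ∀ {s} → Tree s → Set
    TreeBar = Bar Grow grow WonInTree

    ChildrenBar : ∀ {s a κs} → Children s a κs → Set
    ChildrenBar = Bar GrowChildren growChildren WonInChildren

    childrenBar-∷ : ∀ {s a κ κs} {t : Tree (child s a κ)} → TreeBar t →
      (ts : Children s a κs) → ChildrenBar ts → ChildrenBar (t ∷ ts)
    childrenBar-∷ (now w)    _  _ = now (inj₁ w)
    childrenBar-∷ {t = t} (later f) ts b = inner ts b
      where
      inner : (ts : Children _ _ _) → ChildrenBar ts → ChildrenBar (t ∷ ts)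
      inner ts (now w)   = now (inj₂ w)
      inner ts (later g) = later λ
        { (inj₁ m) → childrenBar-∷ (f m) ts (later g)
        ; (inj₂ m) → inner (growChildren ts m) (g m) }

    nodeBar : ∀ {s a} {a> : All (_< a) (chosen s)} {ts : Children s a (patterns (chosen s) a)} →
      ChildrenBar ts → TreeBar (node a a> ts)
    nodeBar (now w)   = now (inj₂ w)
    nodeBar (later f) = later λ m → nodeBar (f m)

    childrenBar : ∀ {s a κs} → (∀ κ → IsPattern s a κ → (t : Tree (child s a κ)) → TreeBar t) →
      (∀ κ → κ ∈ κs → IsPattern s a κ) → (ts : Children s a κs) → ChildrenBar ts
    childrenBar h isPattern []                 = later λ ()
    childrenBar {κs = κ ∷ κs} h isPattern (t ∷ ts) =
      childrenBar-∷ (h κ (isPattern κ (here refl)) t) ts (childrenBar h (λ κ′ m → isPattern κ′ (there m)) ts)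

    mutual
      treeBar : ∀ s → Winnable j s → (t : Tree s) → TreeBar t
      treeBar s (now w)   t              = now (inj₁ w)
      treeBar s (later f) leaf           = later λ { (z , z>) → nodeBar (childrenBarAt s f z z> (leaves _)) }
      treeBar s (later f) (node a a> ts) = nodeBar (childrenBarAt s f a a> ts)

      childrenBarAt : ∀ s → ((m : Move j s) → Winnable j (play j s m)) → ∀ a (a> : All (_< a) (chosen s)) →
        (ts : Children s a (patterns (chosen s) a)) → ChildrenBar ts
      childrenBarAt s f a a> = childrenBar
        (λ κ isPattern → treeBar (child s a κ) (f (childMove s a a> κ isPattern)))
        (λ κ → ∈-choices⁻ (newColourOptions (chosen s) a))

    EndHomogeneous : State → State → Set
    EndHomogeneous h s = ∀ Y z → Y ++ [ z ] ⊆ chosen s → length Y ≡ j → colour h (Y ++ [ z ]) ≡ colour s Y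

    mutual
      Embeds : State → ∀ {s} → Tree s → Set
      Embeds h {s} t = chosen s ⊆ chosen h × EndHomogeneous h s × EmbedsBelow h t

      EmbedsBelow : State → ∀ {s} → Tree s → Set
      EmbedsBelow h leaf              = ⊤
      EmbedsBelow h {s} (node a _ ts) = chosen s ++ [ a ] ⊆ chosen h × EmbedsChildren h ts

      EmbedsChildren : State → ∀ {s a κs} → Children s a κs → Set
      EmbedsChildren h []       = ⊤
      EmbedsChildren h (t ∷ ts) = Embeds h t × EmbedsChildren h ts

    nonEmpty : ∀ (Y : List ℕ) {n} → length Y ≡ suc n → Y ≢ []
    nonEmpty (_ ∷ _) _ ()

    split-∷ʳ : ∀ (Z : List ℕ) n → length Z ≡ suc n → ∃ λ Y → ∃ λ z → Z ≡ Y ++ [ z ] × length Y ≡ n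
    split-∷ʳ (x ∷ [])     zero    refl = [] , x , refl , refl
    split-∷ʳ (x ∷ y ∷ Z) (suc n) e with split-∷ʳ (y ∷ Z) n (suc-injective e)
    ... | Y , z , e′ , ∣Y∣ = x ∷ Y , z , cong (x ∷_) e′ , cong suc ∣Y∣

    won-lift : ∀ {h s} → chosen s ⊆ chosen h → EndHomogeneous h s → Won j s → Won k h
    won-lift {h} {s} s⊆h endHom (H , H⊆ , ∣H∣ , homogeneous) = H , ⊆-trans H⊆ s⊆h , ∣H∣ , homogeneous′
      where
      homogeneous′ : MinHomogeneous k (colour h) H
      homogeneous′ Z Z′ Z⊆ Z′⊆ ∣Z∣ ∣Z′∣ first≡ with split-∷ʳ Z j ∣Z∣ | split-∷ʳ Z′ j ∣Z′∣
      ... | Y , z , refl , ∣Y∣ | Y′ , z′ , refl , ∣Y′∣ = begin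
        colour h (Y ++ [ z ])    ≡⟨ endHom Y z (⊆-trans Z⊆ H⊆) ∣Y∣ ⟩
        colour s Y               ≡⟨ homogeneous Y Y′ (∷ʳ-⊆ z Z⊆) (∷ʳ-⊆ z′ Z′⊆) ∣Y∣ ∣Y′∣ first≡′ ⟩
        colour s Y′              ≡⟨ endHom Y′ z′ (⊆-trans Z′⊆ H⊆) ∣Y′∣ ⟨
        colour h (Y′ ++ [ z′ ])  ∎
        where
        open ≡-Reasoning
        first≡′ : first Y ≡ first Y′
        first≡′ = trans (sym (first-++ Y [ z ] (nonEmpty Y ∣Y∣)))
                        (trans first≡ (first-++ Y′ [ z′ ] (nonEmpty Y′ ∣Y′∣)))

    mutual
      won-embedded : ∀ h {s} (t : Tree s) → Embeds h t → WonInTree t → Won k h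
      won-embedded h t              (s⊆h , endHom , _) (inj₁ w) = won-lift s⊆h endHom w
      won-embedded h (node _ _ ts)  (_ , _ , _ , e)    (inj₂ w) = won-embeddedChildren h ts e w

      won-embeddedChildren : ∀ h {s a κs} (ts : Children s a κs) → EmbedsChildren h ts → WonInChildren ts → Won k h
      won-embeddedChildren h (t ∷ ts) (e , _) (inj₁ w) = won-embedded h t e w
      won-embeddedChildren h (t ∷ ts) (_ , e) (inj₂ w) = won-embeddedChildren h ts e w

    -- A move (v, c′) of the k-game at h is answered in the tree by walking from the root along the
    -- children whose pattern is the colouring Y ↦ c′ (Y ++ [ v ]), until a leaf is reached; v is put there.
    module Insert (h : State) (v : ℕ) (c′ : List ℕ → C) (h<v : All (_< v) (chosen h))
                  (agree : AgreeOn k (chosen h) c′ (colour h)) (admissibleAt : AdmissibleAt k (chosen h) v c′) where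
      h′ : State
      h′ = state (chosen h ++ [ v ]) c′

      Records : State → Set
      Records s = AgreeOn j (chosen s) (λ Y → c′ (Y ++ [ v ])) (colour s)

      endHomogeneous-play : ∀ {s} → chosen s ⊆ chosen h → EndHomogeneous h s → EndHomogeneous h′ s
      endHomogeneous-play s⊆h endHom Y z Yz⊆ ∣Y∣ =
        trans (agree (Y ++ [ z ]) (⊆-trans Yz⊆ s⊆h) (trans (length-∷ʳ Y z) (cong suc ∣Y∣))) (endHom Y z Yz⊆ ∣Y∣)

      mutual
        embeds-play : ∀ {s} (t : Tree s) → Embeds h t → Embeds h′ t
        embeds-play t (s⊆h , endHom , e) = ⊆-∷ʳ v s⊆h , endHomogeneous-play s⊆h endHom , embedsBelow-play t e

        embedsBelow-play : ∀ {s} (t : Tree s) → EmbedsBelow h t → EmbedsBelow h′ t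
        embedsBelow-play leaf          tt          = tt
        embedsBelow-play (node a _ ts) (sa⊆h , e) = ⊆-∷ʳ v sa⊆h , embedsChildren-play ts e

        embedsChildren-play : ∀ {s a κs} (ts : Children s a κs) → EmbedsChildren h ts → EmbedsChildren h′ ts
        embedsChildren-play []       tt      = tt
        embedsChildren-play (t ∷ ts) (e , es) = embeds-play t e , embedsChildren-play ts es

      patternOf : List ℕ → ℕ → List C
      patternOf us a = map (λ Y → c′ (Y ++ [ v ])) (extensions i us a)

      patternOf-∈ : ∀ s a → chosen s ++ [ a ] ⊆ chosen h → patternOf (chosen s) a ∈ patterns (chosen s) a
      patternOf-∈ s a sa⊆h =
        ∈-choices-map⁺ (λ Y → c′ (Y ++ [ v ])) (λ Y → admissible (first Y)) (extensions i (chosen s) a)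
          admissibleExtension
        where
        admissibleExtension : ∀ Y → Y ∈ extensions i (chosen s) a → c′ (Y ++ [ v ]) ∈ admissible (first Y)
        admissibleExtension Y m with ∈-extensions⁻ i (chosen s) a m
        ... | ws , refl , ws⊆ , ∣ws∣ =
          subst (λ x → c′ ((ws ++ [ a ]) ++ [ v ]) ∈ admissible x) (first-++ (ws ++ [ a ]) [ v ] (∷ʳ≢[] ws a))
            (admissibleAt (ws ++ [ a ]) (⊆-trans (∷ʳ-⊆-∷ʳ a ws⊆) sa⊆h) (trans (length-∷ʳ ws a) (cong suc ∣ws∣)))

      records-child : ∀ s a → Records s → All (_< a) (chosen s) → Records (child s a (patternOf (chosen s) a))
      records-child s a records s<a = agreeOn-recolour i (chosen s) a (λ Y → c′ (Y ++ [ v ])) (colour s) s<a records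

      endHomogeneous-leaf : ∀ s κ → chosen s ⊆ chosen h → EndHomogeneous h s → Records s →
        EndHomogeneous h′ (child s v κ)
      endHomogeneous-leaf s κ s⊆h endHom records Y z Yz⊆ ∣Y∣ with ⊆-∷ʳ⁻ (chosen s) v Yz⊆
      ... | inj₁ Yz⊆s =
        trans (endHomogeneous-play s⊆h endHom Y z Yz⊆s ∣Y∣)
              (sym (recolour-∉ i (colour s) v (chosen s) κ Y (∉-above (∷ʳ-⊆ z Yz⊆s) (All-resp-⊆ s⊆h h<v))))
      ... | inj₂ (ws , e , ws⊆) with ∷ʳ-injective Y ws e
      ...   | refl , refl = trans (records ws ws⊆ ∣Y∣)
                              (sym (recolour-∉ i (colour s) v (chosen s) κ ws (∉-above ws⊆ (All-resp-⊆ s⊆h h<v))))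

      embedsLeaves : ∀ s → chosen s ⊆ chosen h → EndHomogeneous h s → Records s →
        ∀ κs → EmbedsChildren h′ (leaves {s} {v} κs)
      embedsLeaves s s⊆h endHom records []       = tt
      embedsLeaves s s⊆h endHom records (κ ∷ κs) =
        (∷ʳ-⊆-∷ʳ v s⊆h , endHomogeneous-leaf s κ s⊆h endHom records , tt) ,
        embedsLeaves s s⊆h endHom records κs

      mutual
        insert : ∀ {s} (t : Tree s) → Embeds h t → Records s → Σ (Grow t) λ m → Embeds h′ (grow t m)
        insert {s} leaf (s⊆h , endHom , tt) records =
          (v , All-resp-⊆ s⊆h h<v) ,
          (⊆-∷ʳ v s⊆h , endHomogeneous-play s⊆h endHom , ∷ʳ-⊆-∷ʳ v s⊆h ,
           embedsLeaves s s⊆h endHom records (patterns (chosen s) v))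
        insert {s} (node a s<a ts) (s⊆h , endHom , sa⊆h , e) records
          with insertChildren ts e (patternOf-∈ s a sa⊆h) (records-child s a records s<a)
        ... | m , e′ = m , (⊆-∷ʳ v s⊆h , endHomogeneous-play s⊆h endHom , ⊆-∷ʳ v sa⊆h , e′)

        insertChildren : ∀ {s a κs} (ts : Children s a κs) → EmbedsChildren h ts → patternOf (chosen s) a ∈ κs →
          Records (child s a (patternOf (chosen s) a)) →
          Σ (GrowChildren ts) λ m → EmbedsChildren h′ (growChildren ts m)
        insertChildren (t ∷ ts) (e , es) (here refl) records with insert t e records
        ... | m , e′ = inj₁ m , (e′ , embedsChildren-play ts es)
        insertChildren (t ∷ ts) (e , es) (there κ∈) records with insertChildren ts es κ∈ records
        ... | m , es′ = inj₂ m , (embeds-play t e , es′)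

    records-start : ∀ (c′ : List ℕ → C) v Y → Y ⊆ [] → length Y ≡ j → c′ (Y ++ [ v ]) ≡ colour start Y
    records-start c′ v .[] [] ()

    embeds-start : Embeds start {start} leaf
    embeds-start = [] , (λ { Y z Yz⊆ _ → ⊥-elim (∷ʳ≢[] Y z (empty⊆ Yz⊆)) }) , tt
      where
      empty⊆ : ∀ {xs : List ℕ} → xs ⊆ [] → xs ≡ []
      empty⊆ [] = refl

    winnable-embedded : ∀ (t : Tree start) → TreeBar t → ∀ h → Embeds h t → Winnable k h
    winnable-embedded t (now w)   h e = now (won-embedded h t e w)
    winnable-embedded t (later f) h e = later λ { m@(v , c′ , h<v , agree , admissibleAt) →
      let m′ , e′ = Insert.insert h v c′ h<v agree admissibleAt t e (records-start c′ v)
      in  winnable-embedded (grow t m′) (f m′) (play k h m) e′ }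

    winnable-suc : Winnable j start → Winnable k start
    winnable-suc b = winnable-embedded leaf (treeBar start b leaf) start embeds-start

  winnable : ∀ i → Winnable (suc i) start
  winnable zero    = winnable-1
  winnable (suc i) = ErdosRado.winnable-suc i (winnable i)

  supremum : {X : Set} (xs : List X) → (∀ x → x ∈ xs → ℕ) → ℕ
  supremum []       f = 0
  supremum (x ∷ xs) f = f x (here refl) ⊔ supremum xs (λ y m → f y (there m))

  ≤-supremum : {X : Set} (xs : List X) (f : ∀ x → x ∈ xs → ℕ) (x : X) (m : x ∈ xs) → f x m ≤ supremum xs f
  ≤-supremum (y ∷ xs) f x (here refl) = m≤m⊔n _ _
  ≤-supremum (y ∷ xs) f x (there m)   = ≤-trans (≤-supremum xs (λ y m → f y (there m)) x m) (m≤n⊔m _ _)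

  hasMinHomogeneous-mono : ∀ j {M M′} c → M ≤ M′ → HasMinHomogeneous j (range M) c →
    HasMinHomogeneous j (range M′) c
  hasMinHomogeneous-mono j c M≤M′ (H , H⊆ , ∣H∣ , homogeneous) =
    H , ⊆-trans H⊆ (range-mono M≤M′) , ∣H∣ , homogeneous

  AdmissibleBelow : ℕ → (List ℕ → C) → ℕ → Set
  AdmissibleBelow j c M = ∀ N → N < M → AdmissibleAt j (range N) N c

  BoundedFrom : ℕ → ℕ → (List ℕ → C) → Set
  BoundedFrom j N c₀ = Σ ℕ λ M →
    ∀ c → AgreeOn j (range N) c c₀ → AdmissibleBelow j c M → HasMinHomogeneous j (range M) c

  -- The fan theorem for the finitely branching game: the bound is the maximum over the finitely many
  -- patterns the opponent can choose when adding N.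
  boundedFrom : ∀ i N c₀ → Winnable (suc i) (state (range N) c₀) → BoundedFrom (suc i) N c₀
  boundedFrom i N c₀ (now (H , H⊆ , ∣H∣ , homogeneous)) = N , λ c agree _ → H , H⊆ , ∣H∣ ,
    λ Z Z′ Z⊆ Z′⊆ ∣Z∣ ∣Z′∣ first≡ →
      trans (agree Z (⊆-trans Z⊆ H⊆) ∣Z∣)
            (trans (homogeneous Z Z′ Z⊆ Z′⊆ ∣Z∣ ∣Z′∣ first≡) (sym (agree Z′ (⊆-trans Z′⊆ H⊆) ∣Z′∣)))
  boundedFrom i N c₀ (later f) = M , bounded
    where
    open Patterns i
    s : State
    s = state (range N) c₀

    ih : ∀ κ → κ ∈ patterns (range N) N → BoundedFrom (suc i) (suc N) (recolour i c₀ N (range N) κ)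
    ih κ κ∈ = boundedFrom i (suc N) _
      (f (childMove s N (range-< N) κ (∈-choices⁻ (newColourOptions (range N) N) κ∈)))

    childBound : ℕ
    childBound = supremum (patterns (range N) N) (λ κ κ∈ → proj₁ (ih κ κ∈))

    M : ℕ
    M = suc N ⊔ childBound

    bounded : ∀ c → AgreeOn (suc i) (range N) c c₀ → AdmissibleBelow (suc i) c M →
      HasMinHomogeneous (suc i) (range M) c
    bounded c agree admissible-c = hasMinHomogeneous-mono (suc i) c M₁≤M
      (proj₂ (ih κ κ∈) c agree′ (λ N′ N′< → admissible-c N′ (≤-trans N′< M₁≤M)))
      where
      κ : List C
      κ = map c (extensions i (range N) N)

      κ∈ : κ ∈ patterns (range N) N
      κ∈ = ∈-choices-map⁺ c (λ Y → admissible (first Y)) (extensions i (range N) N) admissibleExtension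
        where
        admissibleExtension : ∀ Y → Y ∈ extensions i (range N) N → c Y ∈ admissible (first Y)
        admissibleExtension Y m with ∈-extensions⁻ i (range N) N m
        ... | ws , refl , ws⊆ , ∣ws∣ =
          admissible-c N (≤-trans (n<1+n N) (m≤m⊔n (suc N) childBound)) ws ws⊆ ∣ws∣

      M₁≤M : proj₁ (ih κ κ∈) ≤ M
      M₁≤M = ≤-trans (≤-supremum (patterns (range N) N) (λ κ κ∈ → proj₁ (ih κ κ∈)) κ κ∈)
                     (m≤n⊔m (suc N) childBound)

      agree′ : AgreeOn (suc i) (range (suc N)) c (recolour i c₀ N (range N) κ)
      agree′ = agreeOn-recolour i (range N) N c c₀ (range-< N) agree

  kanamoriMcAloon : ∀ i → Σ ℕ λ M →
    ∀ c → AdmissibleBelow (suc i) c M → HasMinHomogeneous (suc i) (range M) c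
  kanamoriMcAloon i with boundedFrom i 0 (λ _ → default) (winnable i)
  ... | M , bounded = M , λ c → bounded c (λ { .[] [] () })

-- Regressive functions

module Regressive (i r p : ℕ) where
  k : ℕ
  k = suc i

  shapes : List (Vec (Fin k) k)
  shapes = allTuples k k

  valueOptions : ℕ → List (List ℕ)
  valueOptions a = choices (replicate r (range (suc a)))

  admissible : ℕ → List (List (List ℕ))
  admissible a = choices (map (λ _ → valueOptions a) shapes)

  open Game (List (List ℕ)) [] admissible (p + i) public using (MinHomogeneous; kanamoriMcAloon)

  module Colour (n′ : ℕ) (F : Vec (Fin (suc n′)) k → Vec (Fin (suc n′)) r) where
    n : ℕ
    n = suc n′

    toFin : ℕ → Fin n
    toFin = clamp n′

    at : List ℕ → Vec (Fin k) k → Vec (Fin n) k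
    at Y τ = Vec.map (λ t → toFin (nth Y (toℕ t))) τ

    clipAt : ℕ → ∀ {m} → Vec (Fin n) m → Vec (Fin n) m
    clipAt a = Vec.map (λ f → toFin (toℕ f ⊓ a))

    colourOf : List ℕ → List (List ℕ)
    colourOf Y = map (λ τ → coords (clipAt (first Y) (F (at Y τ)))) shapes

    coords-clipAt-∈ : ∀ a (w : Vec (Fin n) r) → coords (clipAt a w) ∈ valueOptions a
    coords-clipAt-∈ a w = ∈-choices⁺ (clipped w)
      where
      clipped : ∀ {m} (w : Vec (Fin n) m) → Pointwise _∈_ (coords (clipAt a w)) (replicate m (range (suc a)))
      clipped []      = []
      clipped (f ∷ w) = ∈-range⁺ (s≤s (≤-trans (toℕ-clamp-≤ n′ _) (m⊓n≤n (toℕ f) a))) ∷ clipped w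

    colourOf-admissible : ∀ Y → colourOf Y ∈ admissible (first Y)
    colourOf-admissible Y = ∈-choices-map⁺ _ _ shapes (λ τ _ → coords-clipAt-∈ (first Y) (F (at Y τ)))

    clipAt-bounded : ∀ a {m} (w : Vec (Fin n) m) → maxCoord w ≤ a → clipAt a w ≡ w
    clipAt-bounded a []      _  = refl
    clipAt-bounded a (f ∷ w) w≤a = cong₂ _∷_
      (trans (cong toFin (m≤n⇒m⊓n≡m (m⊔n≤o⇒m≤o (toℕ f) _ w≤a))) (clamp-toℕ f))
      (clipAt-bounded a w (m⊔n≤o⇒n≤o (toℕ f) _ w≤a))

    shapeOf : List ℕ → ∀ {m} → Vec (Fin n) m → Vec (Fin k) m
    shapeOf Y = Vec.map (λ f → clamp i (position (toℕ f) Y))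

    at-shapeOf : ∀ Y → length Y ≡ k → ∀ {m} (x : Vec (Fin n) m) → (∀ {v} → v ∈ coords x → v ∈ Y) →
      Vec.map (λ t → toFin (nth Y (toℕ t))) (shapeOf Y x) ≡ x
    at-shapeOf Y ∣Y∣ []      _    = refl
    at-shapeOf Y ∣Y∣ (f ∷ x) x⊆Y = cong₂ _∷_ entry (at-shapeOf Y ∣Y∣ x (λ v∈ → x⊆Y (there v∈)))
      where
      f∈Y : toℕ f ∈ Y
      f∈Y = x⊆Y (here refl)
      entry : toFin (nth Y (toℕ (clamp i (position (toℕ f) Y)))) ≡ f
      entry = begin
        toFin (nth Y (toℕ (clamp i (position (toℕ f) Y))))
          ≡⟨ cong (λ j → toFin (nth Y j)) (toℕ-clamp (s≤s⁻¹ (subst (position (toℕ f) Y <_) ∣Y∣ (position-< f∈Y)))) ⟩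
        toFin (nth Y (position (toℕ f) Y))  ≡⟨ cong toFin (nth-position f∈Y) ⟩
        toFin (toℕ f)                       ≡⟨ clamp-toℕ f ⟩
        f                                   ∎
        where open ≡-Reasoning

    module Witness (M : ℕ) (M≤n′ : M ≤ n′) (H : List ℕ) (H⊆ : H ⊆ range M) (∣H∣ : length H ≡ p + i)
             (homogeneous : MinHomogeneous k colourOf H)
             (regressive : (x : Vec (Fin n) k) → maxCoord (F x) ≤ minCoord x) where
      Hp Hx : List ℕ
      Hp = take p H
      Hx = drop p H

      Hp++Hx : Hp ++ Hx ≡ H
      Hp++Hx = take++drop≡id p H

      ∣Hp∣ : length Hp ≡ p
      ∣Hp∣ = length-take-≤ p H (subst (p ≤_) (sym ∣H∣) (m≤m+n p i))

      ∣Hx∣ : length Hx ≡ i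
      ∣Hx∣ = trans (length-drop p H) (trans (cong (_∸ p) ∣H∣) (m+n∸m≡n p i))

      Hp⊆H : Hp ⊆ H
      Hp⊆H = take-⊆ p H

      unique : ∀ {S} → S ⊆ Hp → Unique S
      unique S⊆ = AllPairs.map <⇒≢ (AllPairs-resp-⊇ (⊆-trans (⊆-trans S⊆ Hp⊆H) H⊆) (range-increasing M))

      map-toℕ-toFin : map toℕ (map toFin Hp) ≡ Hp
      map-toℕ-toFin = trans (sym (map-∘ Hp)) (map-id-local
        (All.map (λ h<M → toℕ-clamp (≤-trans (<⇒≤ h<M) M≤n′)) (All-resp-⊆ (⊆-trans Hp⊆H H⊆) (range-< M))))

      E : Subset n
      E = subsetOf (map toFin Hp)

      ∣E∣ : ∣ E ∣ ≡ p
      ∣E∣ = trans (∣subsetOf∣ (Unique.map⁻ (subst Unique (sym map-toℕ-toFin) (unique ⊆-refl))))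
                  (trans (length-map toFin Hp) ∣Hp∣)

      ∈E⇒∈Hp : ∀ {f} → f ∈ₛ E → toℕ f ∈ Hp
      ∈E⇒∈Hp f∈E = subst (_ ∈_) map-toℕ-toFin (∈-map⁺ toℕ (∈-subsetOf⁻ (map toFin Hp) f∈E))

      record Completion (x : Vec (Fin n) k) : Set where
        field
          least    : ℕ
          rest     : List ℕ
          least∈Hp : least ∈ Hp
          least∈x  : least ∈ coords x
          Y⊆H      : least ∷ rest ⊆ H
          ∣Y∣      : length (least ∷ rest) ≡ k
          x⊆Y      : ∀ {v} → v ∈ coords x → v ∈ least ∷ rest

      -- The coordinates of x, in increasing order, padded with elements of Hx to a k-set.
      completion : ∀ x → (∀ {v} → v ∈ coords x → v ∈ Hp) → Completion x
      completion x@(f ∷ _) x⊆Hp = fromSelection (filter (_∈? coords x) Hp) (filter-⊆ (_∈? coords x) Hp)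
        (λ v∈ → ∈-filter⁺ (_∈? coords x) (x⊆Hp v∈) v∈)
        (λ v∈ → proj₂ (∈-filter⁻ (_∈? coords x) {xs = Hp} v∈))
        where
        fromSelection : ∀ S → S ⊆ Hp → (∀ {v} → v ∈ coords x → v ∈ S) → (∀ {v} → v ∈ S → v ∈ coords x) →
          Completion x
        fromSelection []      _   x⊆S _   with () ← x⊆S (here refl)
        fromSelection (a ∷ S) S⊆ x⊆S S⊆x = record
          { least    = a
          ; rest     = S ++ padding
          ; least∈Hp = Sublist.lookup S⊆ (here refl)
          ; least∈x  = S⊆x (here refl)
          ; Y⊆H      = subst (a ∷ S ++ padding ⊆_) Hp++Hx (++⁺ S⊆ (take-⊆ (k ∸ length (a ∷ S)) Hx))
          ; ∣Y∣      = begin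
              length ((a ∷ S) ++ padding)        ≡⟨ length-++ (a ∷ S) ⟩
              length (a ∷ S) + length padding    ≡⟨ cong (length (a ∷ S) +_) ∣padding∣ ⟩
              length (a ∷ S) + (k ∸ length (a ∷ S)) ≡⟨ m+[n∸m]≡n ∣S∣≤k ⟩
              k                                  ∎
          ; x⊆Y      = λ v∈ → ∈-++⁺ˡ (x⊆S v∈)
          }
          where
          open ≡-Reasoning
          padding : List ℕ
          padding = take (k ∸ length (a ∷ S)) Hx
          ∣padding∣ : length padding ≡ k ∸ length (a ∷ S)
          ∣padding∣ = length-take-≤ _ Hx (subst (i ∸ length S ≤_) (sym ∣Hx∣) (m∸n≤m i (length S)))
          ∣S∣≤k : length (a ∷ S) ≤ k
          ∣S∣≤k = subst (length (a ∷ S) ≤_) (length-coords x) (Unique-length-≤ (unique S⊆) S⊆x)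

      imageList : List (Vec (Fin n) r)
      imageList = concatMap (λ a → map (λ τ → clipAt a (F (at (a ∷ Hx) τ))) shapes) Hp

      length-imageList : length imageList ≡ k ^ k * p
      length-imageList = begin
        length imageList
          ≡⟨ length-concatMap-const _ Hp (k ^ k) (λ a → trans (length-map _ shapes) (length-allTuples k k)) ⟩
        length Hp * k ^ k ≡⟨ cong (_* k ^ k) ∣Hp∣ ⟩
        p * k ^ k         ≡⟨ *-comm p (k ^ k) ⟩
        k ^ k * p         ∎
        where open ≡-Reasoning

      -- The completion of x and least ∷ Hx are k-sets with the same least element, hence of the same colour.
      F∈imageList : ∀ x → (∀ {v} → v ∈ coords x → v ∈ Hp) → F x ∈ imageList
      F∈imageList x x⊆Hp = subst (_∈ imageList) (sym Fx≡)
        (∈-concatMap⁺ (λ a → map (λ τ → clipAt a (F (at (a ∷ Hx) τ))) shapes)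
          (Any.map (λ { refl → ∈-map⁺ (λ τ → clipAt least (F (at (least ∷ Hx) τ))) (∈-allTuples k k τ) })
            least∈Hp))
        where
        open Completion (completion x x⊆Hp)
        open ≡-Reasoning
        τ : Vec (Fin k) k
        τ = shapeOf (least ∷ rest) x

        sameColour : colourOf (least ∷ rest) ≡ colourOf (least ∷ Hx)
        sameColour = homogeneous (least ∷ rest) (least ∷ Hx) Y⊆H
          (subst (least ∷ Hx ⊆_) Hp++Hx (++⁺ (from∈ least∈Hp) ⊆-refl)) ∣Y∣ (cong suc ∣Hx∣) refl

        Fx≡ : F x ≡ clipAt least (F (at (least ∷ Hx) τ))
        Fx≡ = begin
          F x
            ≡⟨ clipAt-bounded least (F x) (≤-trans (regressive x) (minCoord-≤ x least∈x)) ⟨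
          clipAt least (F x)
            ≡⟨ cong (λ z → clipAt least (F z)) (at-shapeOf (least ∷ rest) ∣Y∣ x x⊆Y) ⟨
          clipAt least (F (at (least ∷ rest) τ))
            ≡⟨ coords-injective _ _ (map-≡-∈ shapes sameColour (∈-allTuples k k τ)) ⟩
          clipAt least (F (at (least ∷ Hx) τ))
            ∎

      imageCard-≤ : imageCard F E ≤ k ^ k * p
      imageCard-≤ = ≤-trans (Unique-length-≤ (deduplicate-! (map F (power E k))) image⊆)
                            (≤-reflexive length-imageList)
        where
        open UniqueDec (VecP.≡-dec {n = r} (_≟F_ {n})) using (deduplicate-!)

        coords⊆Hp : ∀ {m} (x : Vec (Fin n) m) → VAll.All (_∈ₛ E) x → ∀ {v} → v ∈ coords x → v ∈ Hp
        coords⊆Hp (f ∷ x) (f∈E VAll.∷ _)  (here refl) = ∈E⇒∈Hp f∈E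
        coords⊆Hp (f ∷ x) (_ VAll.∷ x⊆E)  (there v∈)  = coords⊆Hp x x⊆E v∈

        image⊆ : ∀ {y} → y ∈ deduplicate (VecP.≡-dec _≟F_) (map F (power E k)) → y ∈ imageList
        image⊆ y∈ with ∈-map⁻ F (∈-deduplicate⁻ (VecP.≡-dec _≟F_) (map F (power E k)) y∈)
        ... | x , x∈ , refl =
          F∈imageList x (coords⊆Hp x (proj₂ (∈-filter⁻ (λ z → VAll.all? (_∈?ₛ E) z) {xs = allTuples n k} x∈)))

  smallImage : Σ ℕ λ m → ∀ n′ → m ≤ n′ → (F : Vec (Fin (suc n′)) k → Vec (Fin (suc n′)) r) →
    ((x : Vec (Fin (suc n′)) k) → maxCoord (F x) ≤ minCoord x) →
    Σ (Subset (suc n′)) λ E → ∣ E ∣ ≡ p × imageCard F E ≤ k ^ k * p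
  smallImage with kanamoriMcAloon i
  ... | M , minHomogeneous = M , λ n′ M≤n′ F regressive →
    let open Colour n′ F
        H , H⊆ , ∣H∣ , homogeneous = minHomogeneous colourOf (λ N _ ws _ _ → colourOf-admissible (ws ++ [ N ]))
        open Witness M M≤n′ H H⊆ ∣H∣ homogeneous regressive
    in  E , ∣E∣ , imageCard-≤

theorem0p3 : (k r p : ℕ) → k > 0 → r > 0 → p > 0 →
    Σ ℕ (λ m → (n : ℕ) → n ≥ m → (F : Vec (Fin n) k → Vec (Fin n) r) →
    ((x : Vec (Fin n) k) → maxCoord (F x) ≤ minCoord x) →
    Σ (Subset n) (λ E → ∣ E ∣ ≡ p × imageCard F E ≤ k ^ k * p))
theorem0p3 (suc i) r p _ _ _ with Regressive.smallImage i r p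
... | m , smallImage = suc m , λ { (suc n′) (s≤s m≤n′) → smallImage n′ m≤n′ }
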